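{- There exists $c_0>0$ such that for every $\delta\in(0,c_0]$ and every integer $k\ge 1/c_0$ there exists $n_0$ such that for all $n\ge n_0$ the following holds. Let $\mathcal{H}$ be a $3$-graph on $n$ vertices and let $T\subset V(\mathcal{H})$ be a set of vertices meeting at least $\delta n^3$ edges of $\mathcal{H}$. Then $\mathcal{H}$ contains a double pyramid on $2k+2$ vertices with both apexes in $T$.
   Context: A $3$-graph has a finite vertex set and edges which are $3$-element subsets. A double pyramid on $m+2$ vertices ($m\ge 3$) in $\mathcal{H}$ consists of two distinct vertices $x,y$ (the apexes) and a cycle $v_1v_2\dots v_m v_1$ of further distinct vertices, such that $xv_iv_{i+1}$ and $yv_iv_{i+1}$ are edges of $\mathcal{H}$ for all $i$ (indices mod $m$); the set of these $2m$ edges forms a copy of the $2$-sphere.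
   Formalization: The parameter δ ranges over the rationals, and the constant $c_0$ is taken in the rationals. -}

module Defs where

open import Data.Nat using (ℕ; zero; suc; _≤_; _≟_)
open import Data.Bool using (Bool; true; false; T)
open import Data.Fin using (Fin; zero; suc)
open import Data.Fin.Subset using (Subset; ⁅_⁆; _∪_; _∩_; ∣_∣; Nonempty; _∉_)
open import Data.Fin.Subset.Properties using (nonempty?)
import Data.Vec as V
open import Data.List using (List; _++_; map; filter; length)
import Data.List as L
open import Data.Product using (_×_)
open import Data.Unit using (⊤)
open import Function.Definitions using (Injective)
open import Relation.Binary.PropositionalEquality using (_≡_; _≢_)
open import Relation.Nullary.Decidable using (_×-dec_; T?)
open import Data.Rational using (ℚ; _*_; _≤_; _/_)
open import Data.Integer using (+_)

-- A 3-graph on the vertex set Fin n: it is given by an indicator on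
-- subsets of Fin n; the edges are exactly the 3-element subsets S with
-- H S ≡ true (values of H on subsets of other sizes are irrelevant).
3Graph : ℕ → Set
3Graph n = Subset n → Bool

IsEdge : ∀ {n} → 3Graph n → Subset n → Set
IsEdge H S = (∣ S ∣ ≡ 3) × T (H S)

triple : ∀ {n} → Fin n → Fin n → Fin n → Subset n
triple a b c = ⁅ a ⁆ ∪ (⁅ b ⁆ ∪ ⁅ c ⁆)

allSubsets : ∀ n → List (Subset n)
allSubsets zero = V.[] L.∷ L.[]
allSubsets (suc n) = map (true V.∷_) (allSubsets n) ++ map (false V.∷_) (allSubsets n)

edgesMeeting : ∀ {n} → 3Graph n → Subset n → ℕ
edgesMeeting {n} H T' =
  length (filter (λ S → (∣ S ∣ ≟ 3) ×-dec (T? (H S) ×-dec nonempty? (S ∩ T'))) (allSubsets n))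

-- Cyclic successor on Fin (suc m): i ↦ i + 1 mod (suc m).
cnext : ∀ {m} → Fin (suc m) → Fin (suc m)
cnext {zero} zero = zero
cnext {suc m} zero = suc zero
cnext {suc m} (suc i) with cnext {m} i
... | zero = zero
... | suc j = suc (suc j)

next : ∀ {m} → Fin m → Fin m
next {suc m} i = cnext i

-- A double pyramid on m + 2 vertices (m ≥ 3) in H, with apexes x, y and
-- cycle v₀ v₁ … v_{m-1} v₀.
record DoublePyramid {n : ℕ} (H : 3Graph n) (m : ℕ) : Set where
  field
    m≥3     : 3 Data.Nat.≤ m
    x y     : Fin n
    v       : Fin m → Fin n
    x≢y     : x ≢ y
    v-inj   : Injective _≡_ _≡_ v
    x∉v     : ∀ i → v i ≢ x
    y∉v     : ∀ i → v i ≢ y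
    x-edges : ∀ i → IsEdge H (triple x (v i) (v (next i)))
    y-edges : ∀ i → IsEdge H (triple y (v i) (v (next i)))

ℕtoℚ : ℕ → ℚ
ℕtoℚ n = + n / 1

-- Count the edges meeting T through ordered "admissible" triples
-- (t, a, b): t ∈ T, t, a, b distinct, {t, a, b} an edge.  There are at least
-- δn³ of them.  View them as a bipartite graph between vertices t and ordered
-- pairs (a, b).  A Kővári–Sós–Turán type argument (prune to minimum degrees,
-- then extend greedily) yields two distinct t₁, t₂ ∈ T whose common link
-- {(a, b) : (t₁, a, b), (t₂, a, b) admissible} has Ω(n²) pairs.  The same
-- argument applied to this common link, a bipartite graph on V × V, yields a
-- complete bipartite K_{k,k} with parts u₁ … u_k and w₁ … w_k.  The cycle
-- u₁ w₁ u₂ w₂ … u_k w_k, with apexes t₁ and t₂, is the required double pyramid.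
module Submission where

module FinSum where

  open import Data.Nat using (ℕ; zero; suc; _+_; _*_; _≤_; _<_; z≤n; s≤s)
  open import Data.Nat.Properties
  open import Algebra.Properties.CommutativeSemigroup +-commutativeSemigroup using (interchange; x∙yz≈y∙xz)
  open import Data.Bool using (Bool; true; false; not; T)
  open import Data.Fin using (Fin; zero; suc; _↑ˡ_; _↑ʳ_; combine; remQuot)
  open import Data.Fin.Properties using (remQuot-combine) renaming (_≟_ to _≟F_)
  open import Data.Product using (∃; _,_; proj₁; proj₂)
  open import Function using (_∘_)
  open import Relation.Nullary using (does; yes; no)
  open import Relation.Binary.PropositionalEquality
  open import Data.Empty using (⊥-elim)

  ind : Bool → ℕ
  ind true = 1
  ind false = 0

  ind≤1 : ∀ b → ind b ≤ 1
  ind≤1 true = s≤s z≤n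
  ind≤1 false = z≤n

  ind-T : ∀ {b} → T b → ind b ≡ 1
  ind-T {true} _ = refl

  ind-pos : ∀ b → 0 < ind b → T b
  ind-pos true _ = _

  ind-mono : ∀ {a b} → (T a → T b) → ind a ≤ ind b
  ind-mono {false} f = z≤n
  ind-mono {true} {true} f = ≤-refl
  ind-mono {true} {false} f = ⊥-elim (f _)

  -- Indicator of "i ≢ u"; multiplying by it removes the term at u from a sum.
  neq : ∀ {n} → Fin n → Fin n → Bool
  neq i u = not (does (i ≟F u))

  Σf : ∀ {n} → (Fin n → ℕ) → ℕ
  Σf {zero} f = 0
  Σf {suc n} f = f zero + Σf (f ∘ suc)

  Σ-cong : ∀ {n} {f g : Fin n → ℕ} → (∀ i → f i ≡ g i) → Σf f ≡ Σf g
  Σ-cong {zero} e = refl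
  Σ-cong {suc n} e = cong₂ _+_ (e zero) (Σ-cong (e ∘ suc))

  Σ-mono : ∀ {n} {f g : Fin n → ℕ} → (∀ i → f i ≤ g i) → Σf f ≤ Σf g
  Σ-mono {zero} e = z≤n
  Σ-mono {suc n} e = +-mono-≤ (e zero) (Σ-mono (e ∘ suc))

  Σ-0 : ∀ {n} → Σf {n} (λ _ → 0) ≡ 0
  Σ-0 {zero} = refl
  Σ-0 {suc n} = Σ-0 {n}

  Σ-const : ∀ {n} c → Σf {n} (λ _ → c) ≡ n * c
  Σ-const {zero} c = refl
  Σ-const {suc n} c = cong (c +_) (Σ-const {n} c)

  Σ-+ : ∀ {n} (f g : Fin n → ℕ) → Σf (λ i → f i + g i) ≡ Σf f + Σf g
  Σ-+ {zero} f g = refl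
  Σ-+ {suc n} f g = trans (cong (f zero + g zero +_) (Σ-+ (f ∘ suc) (g ∘ suc)))
                          (interchange (f zero) (g zero) _ _)

  Σ-*ʳ : ∀ {n} (f : Fin n → ℕ) c → Σf (λ i → f i * c) ≡ Σf f * c
  Σ-*ʳ {zero} f c = refl
  Σ-*ʳ {suc n} f c = trans (cong (f zero * c +_) (Σ-*ʳ (f ∘ suc) c))
                           (sym (*-distribʳ-+ c (f zero) (Σf (f ∘ suc))))

  Σ-*ˡ : ∀ {n} c (f : Fin n → ℕ) → Σf (λ i → c * f i) ≡ c * Σf f
  Σ-*ˡ c f = trans (Σ-cong (λ i → *-comm c (f i))) (trans (Σ-*ʳ f c) (*-comm _ c))

  Σ-swap : ∀ {n p} (f : Fin n → Fin p → ℕ) →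
           Σf (λ i → Σf (λ j → f i j)) ≡ Σf (λ j → Σf (λ i → f i j))
  Σ-swap {zero} {p} f = sym (Σ-0 {p})
  Σ-swap {suc n} f = trans (cong (Σf (f zero) +_) (Σ-swap (f ∘ suc)))
                           (sym (Σ-+ (f zero) (λ j → Σf (λ i → f (suc i) j))))

  Σ-split : ∀ {n} (f : Fin n → ℕ) (u : Fin n) →
            Σf f ≡ f u + Σf (λ i → ind (neq i u) * f i)
  Σ-split {suc n} f zero = cong (f zero +_) (Σ-cong {n} (λ i → sym (+-identityʳ _)))
  Σ-split {suc n} f (suc u) = begin
    f zero + Σf (f ∘ suc)                     ≡⟨ cong (f zero +_) (Σ-split (f ∘ suc) u) ⟩
    f zero + (f (suc u) + rest)               ≡⟨ x∙yz≈y∙xz (f zero) (f (suc u)) rest ⟩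
    f (suc u) + (f zero + rest)               ≡⟨ cong (λ a → f (suc u) + (a + rest)) (sym (+-identityʳ (f zero))) ⟩
    f (suc u) + Σf (λ i → ind (neq i (suc u)) * f i) ∎
    where
    open ≡-Reasoning
    rest : ℕ
    rest = Σf (λ i → ind (neq i u) * f (suc i))

  Σ-≥pt : ∀ {n} (f : Fin n → ℕ) u → f u ≤ Σf f
  Σ-≥pt f u rewrite Σ-split f u = m≤m+n (f u) _

  Σ-pos : ∀ {n} (f : Fin n → ℕ) → 0 < Σf f → ∃ λ i → 0 < f i
  Σ-pos {suc n} f p with f zero in eq
  ... | suc _ = zero , subst (0 <_) (sym eq) (s≤s z≤n)
  ... | zero with Σ-pos (f ∘ suc) p
  ...   | i , q = suc i , q

  argmax : ∀ {n} (f : Fin (suc n) → ℕ) → ∃ λ i → ∀ j → f j ≤ f i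
  argmax {zero} f = zero , λ { zero → ≤-refl }
  argmax {suc n} f with argmax (f ∘ suc)
  ... | i , h with f zero ≤? f (suc i)
  ...   | yes le = suc i , λ { zero → le ; (suc j) → h j }
  ...   | no gt = zero , λ { zero → ≤-refl ; (suc j) → ≤-trans (h j) (<⇒≤ (≰⇒> gt)) }

  average : ∀ {n} (f : Fin n → ℕ) → Fin n → ∃ λ i → Σf f ≤ n * f i
  average {suc n} f _ with argmax f
  ... | i , h = i , ≤-trans (Σ-mono h) (≤-reflexive (Σ-const {suc n} (f i)))

  Σ-++ : ∀ m {k} (f : Fin (m + k) → ℕ) → Σf f ≡ Σf (λ i → f (i ↑ˡ k)) + Σf (λ i → f (m ↑ʳ i))
  Σ-++ zero f = refl
  Σ-++ (suc m) f = trans (cong (f zero +_) (Σ-++ m (f ∘ suc))) (sym (+-assoc (f zero) _ _))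

  Σ-combine : ∀ m {k} (f : Fin (m * k) → ℕ) → Σf f ≡ Σf {m} (λ i → Σf {k} (λ j → f (combine i j)))
  Σ-combine zero f = refl
  Σ-combine (suc m) {k} f =
    trans (Σ-++ k {m * k} f) (cong (Σf (λ j → f (j ↑ˡ (m * k))) +_) (Σ-combine m (λ x → f (k ↑ʳ x))))

  Σ-pairs : ∀ m {k} (g : Fin m → Fin k → ℕ) →
            Σf {m * k} (λ p → g (proj₁ (remQuot {m} k p)) (proj₂ (remQuot {m} k p))) ≡ Σf (λ i → Σf (λ j → g i j))
  Σ-pairs m {k} g = trans (Σ-combine m {k} _)
    (Σ-cong (λ i → Σ-cong (λ j → cong (λ x → g (proj₁ x) (proj₂ x)) (remQuot-combine i j))))

-- Pruning a bipartite graph R ⊆ Fin n × Fin p to a nonempty subgraph in which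
-- one left vertex has degree ≥ dL and every right vertex of positive degree has
-- degree ≥ dR.  This is possible as soon as R has more than n·dL + p·dR edges:
-- repeatedly delete a left vertex of degree < dL or a right vertex of degree
-- < dR; the deleted vertices account for at most n·dL + p·dR edges.
module Pruning where

  open import Data.Nat using (ℕ; zero; suc; _+_; _*_; _≤_; _<_; _<?_; z≤n; s≤s)
  open import Data.Nat.Properties
  open import Algebra.Properties.CommutativeSemigroup +-commutativeSemigroup using (x∙yz≈y∙xz)
  open import Data.Bool using (Bool; true; false; _∧_; T)
  open import Data.Bool.Properties using (T?)
  open import Data.Fin using (Fin)
  open import Data.Fin.Properties using (any?)
  open import Data.Product using (∃; _,_; proj₁; proj₂)
  open import Relation.Nullary using (yes; no)
  open import Relation.Nullary.Decidable using (_×-dec_)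
  open import Relation.Binary.PropositionalEquality
  open import Data.Empty using (⊥; ⊥-elim)
  open FinSum

  T∧₁ : ∀ {a b} → T (a ∧ b) → T a
  T∧₁ {true} _ = _

  T∧₂ : ∀ {a b} → T (a ∧ b) → T b
  T∧₂ {true} t = t

  T∧ : ∀ {a b} → T a → T b → T (a ∧ b)
  T∧ {true} _ t = t

  edgeCount : ∀ {n p} → (Fin n → Fin p → Bool) → ℕ
  edgeCount R = Σf (λ u → Σf (λ w → ind (R u w)))

  size : ∀ {n} → (Fin n → Bool) → ℕ
  size A = Σf (λ u → ind (A u))

  size-remove : ∀ {n} (A : Fin n → Bool) u₀ → T (A u₀) → size A ≡ suc (size (λ u → A u ∧ neq u u₀))
  size-remove A u₀ t = trans (Σ-split (λ u → ind (A u)) u₀) (cong₂ _+_ (ind-T t) (Σ-cong (λ u → ind-∧ (A u) (neq u u₀))))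
    where
    ind-∧ : ∀ a c → ind c * ind a ≡ ind (a ∧ c)
    ind-∧ true true = refl
    ind-∧ true false = refl
    ind-∧ false c = *-zeroʳ (ind c)

  record MinDegreeSubgraph {n p : ℕ} (R : Fin n → Fin p → Bool) (dL dR : ℕ) : Set where
    field
      R'          : Fin n → Fin p → Bool
      R'⊆R        : ∀ u w → T (R' u w) → T (R u w)
      root        : Fin n
      root-degree : dL ≤ Σf (λ w → ind (R' root w))
      right-degree : ∀ u w → T (R' u w) → dR ≤ Σf (λ u' → ind (R' u' w))

  -- Paying for one deleted vertex of degree g < a out of the budget.
  pay : ∀ {E s c g a e} → E + s ≤ (g + c) + e → g < a → E + suc s ≤ c + (a + e)
  pay {E} {s} {c} {g} {a} {e} h g<a = begin
    E + suc s       ≡⟨ +-suc E s ⟩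
    suc (E + s)     ≤⟨ s≤s h ⟩
    suc (g + c + e) ≡⟨ cong suc (+-assoc g c e) ⟩
    suc g + (c + e) ≤⟨ +-monoˡ-≤ (c + e) g<a ⟩
    a + (c + e)     ≡⟨ x∙yz≈y∙xz a c e ⟩
    c + (a + e)     ∎
    where open ≤-Reasoning

  module _ {n p : ℕ} (R : Fin n → Fin p → Bool) (dL dR : ℕ) where

    restrict : (Fin n → Bool) → (Fin p → Bool) → Fin n → Fin p → Bool
    restrict A B u w = A u ∧ (B w ∧ R u w)

    degL : (Fin n → Bool) → (Fin p → Bool) → Fin n → ℕ
    degL A B u = Σf (λ w → ind (restrict A B u w))

    degR : (Fin n → Bool) → (Fin p → Bool) → Fin p → ℕ
    degR A B w = Σf (λ u → ind (restrict A B u w))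

    removeL : ∀ A B u₀ → edgeCount (restrict A B) ≡ degL A B u₀ + edgeCount (restrict (λ u → A u ∧ neq u u₀) B)
    removeL A B u₀ = trans (Σ-split (degL A B) u₀) (cong (degL A B u₀ +_) (Σ-cong λ u →
      sym (trans (Σ-cong (λ w → ind-∧ˡ (A u) (neq u u₀) (B w ∧ R u w)))
                 (Σ-*ˡ {p} (ind (neq u u₀)) (λ w → ind (A u ∧ (B w ∧ R u w)))))))
      where
      ind-∧ˡ : ∀ a c X → ind ((a ∧ c) ∧ X) ≡ ind c * ind (a ∧ X)
      ind-∧ˡ true true X = sym (+-identityʳ _)
      ind-∧ˡ true false X = refl
      ind-∧ˡ false c X = sym (*-zeroʳ (ind c))

    removeR : ∀ A B w₀ → edgeCount (restrict A B) ≡ degR A B w₀ + edgeCount (restrict A (λ w → B w ∧ neq w w₀))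
    removeR A B w₀ = begin
      edgeCount (restrict A B)                       ≡⟨ Σ-swap (λ u w → ind (restrict A B u w)) ⟩
      Σf (degR A B)                                  ≡⟨ Σ-split (degR A B) w₀ ⟩
      degR A B w₀ + Σf (λ w → ind (neq w w₀) * degR A B w)
        ≡⟨ cong (degR A B w₀ +_) (Σ-cong λ w → sym (trans (Σ-cong (λ u → ind-∧ʳ (A u) (B w) (neq w w₀) (R u w)))
                                                         (Σ-*ˡ {n} (ind (neq w w₀)) (λ u → ind (A u ∧ (B w ∧ R u w)))))) ⟩
      degR A B w₀ + Σf (degR A B')                    ≡⟨ cong (degR A B w₀ +_) (sym (Σ-swap (λ u w → ind (restrict A B' u w)))) ⟩
      degR A B w₀ + edgeCount (restrict A B')        ∎
      where
      open ≡-Reasoning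
      B' : Fin p → Bool
      B' w = B w ∧ neq w w₀
      ind-∧ʳ : ∀ a b c X → ind (a ∧ ((b ∧ c) ∧ X)) ≡ ind c * ind (a ∧ (b ∧ X))
      ind-∧ʳ true true true X = sym (+-identityʳ _)
      ind-∧ʳ true true false X = refl
      ind-∧ʳ true false c X = sym (*-zeroʳ (ind c))
      ind-∧ʳ false b c X = sym (*-zeroʳ (ind c))

    record State (fuel : ℕ) : Set where
      field
        A           : Fin n → Bool
        B           : Fin p → Bool
        dl dr       : ℕ
        fuel-bound  : size A + size B ≤ fuel
        left-count  : dl + size A ≡ n
        right-count : dr + size B ≡ p
        budget      : edgeCount R + (dl + dr) ≤ edgeCount (restrict A B) + (dl * dL + dr * dR)

    open State

    E : ℕ
    E = edgeCount R

    initial : State (n + p)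
    initial = record
      { A = λ _ → true ; B = λ _ → true ; dl = 0 ; dr = 0
      ; fuel-bound = ≤-reflexive (cong₂ _+_ (size-all {n}) (size-all {p}))
      ; left-count = size-all {n} ; right-count = size-all {p}
      ; budget = ≤-refl
      }
      where
      size-all : ∀ {m} → size {m} (λ _ → true) ≡ m
      size-all {m} = trans (Σ-const {m} 1) (*-identityʳ m)

    deleteLeft : ∀ {f} (s : State (suc f)) u₀ → T (A s u₀) → degL (A s) (B s) u₀ < dL → State f
    deleteLeft s u₀ u₀∈A low = record
      { A = A' ; B = B s ; dl = suc (dl s) ; dr = dr s
      ; fuel-bound = ≤-pred (subst (λ a → a + size (B s) ≤ _) shrink (fuel-bound s))
      ; left-count = trans (sym (+-suc (dl s) _)) (trans (cong (dl s +_) (sym shrink)) (left-count s))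
      ; right-count = right-count s
      ; budget = subst (λ e → E + (suc (dl s) + dr s) ≤ edgeCount (restrict A' (B s)) + e)
                   (sym (+-assoc dL (dl s * dL) (dr s * dR)))
                   (pay (subst (λ c → E + (dl s + dr s) ≤ c + (dl s * dL + dr s * dR)) (removeL (A s) (B s) u₀) (budget s)) low)
      }
      where
      A' : Fin n → Bool
      A' u = A s u ∧ neq u u₀
      shrink : size (A s) ≡ suc (size A')
      shrink = size-remove (A s) u₀ u₀∈A

    deleteRight : ∀ {f} (s : State (suc f)) w₀ → T (B s w₀) → degR (A s) (B s) w₀ < dR → State f
    deleteRight {f} s w₀ w₀∈B low = record
      { A = A s ; B = B' ; dl = dl s ; dr = suc (dr s)
      ; fuel-bound = ≤-pred (subst (_≤ suc f) (trans (cong (size (A s) +_) shrink) (+-suc _ _)) (fuel-bound s))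
      ; left-count = left-count s
      ; right-count = trans (sym (+-suc (dr s) _)) (trans (cong (dr s +_) (sym shrink)) (right-count s))
      ; budget = subst₂ (λ d e → E + d ≤ edgeCount (restrict (A s) B') + e)
                   (sym (+-suc (dl s) (dr s))) (x∙yz≈y∙xz dR (dl s * dL) (dr s * dR))
                   (pay (subst (λ c → E + (dl s + dr s) ≤ c + (dl s * dL + dr s * dR)) (removeR (A s) (B s) w₀) (budget s)) low)
      }
      where
      B' : Fin p → Bool
      B' w = B s w ∧ neq w w₀
      shrink : size (B s) ≡ suc (size B')
      shrink = size-remove (B s) w₀ w₀∈B

    emptyL : (s : State 0) → ∀ u → T (A s u) → ⊥
    emptyL s u t = n≮0 (≤-trans (≤-trans (s≤s z≤n) (≤-reflexive (sym (size-remove (A s) u t)))) (≤-trans (m≤m+n _ _) (fuel-bound s)))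

    emptyR : (s : State 0) → ∀ w → T (B s w) → ⊥
    emptyR s w t = n≮0 (≤-trans (≤-trans (s≤s z≤n) (≤-reflexive (sym (size-remove (B s) w t)))) (≤-trans (m≤n+m _ _) (fuel-bound s)))

    -- When no vertex can be deleted, the budget forces a surviving edge,
    -- whose left end serves as the root.
    finish : ∀ {f} (s : State f) → n * dL + p * dR < edgeCount R →
             (∀ u → T (A s u) → dL ≤ degL (A s) (B s) u) →
             (∀ w → T (B s w) → dR ≤ degR (A s) (B s) w) →
             MinDegreeSubgraph R dL dR
    finish s dense okL okR = record
      { R' = restrict (A s) (B s)
      ; R'⊆R = λ u w t → T∧₂ {B s w} (T∧₂ {A s u} t)
      ; root = root
      ; root-degree = okL root (T∧₁ {A s root} (proj₂ root-edge))
      ; right-degree = λ u w t → okR w (T∧₁ {B s w} (T∧₂ {A s u} t))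
      }
      where
      E' : ℕ
      E' = edgeCount (restrict (A s) (B s))
      paid≤ : dl s * dL + dr s * dR ≤ n * dL + p * dR
      paid≤ = +-mono-≤ (*-monoˡ-≤ dL (≤-trans (m≤m+n (dl s) _) (≤-reflexive (left-count s))))
                       (*-monoˡ-≤ dR (≤-trans (m≤m+n (dr s) _) (≤-reflexive (right-count s))))
      survivors : 0 < E'
      survivors = +-cancelʳ-< (n * dL + p * dR) 0 E' (begin-strict
        n * dL + p * dR        <⟨ dense ⟩
        E                      ≤⟨ ≤-trans (m≤m+n E (dl s + dr s)) (budget s) ⟩
        E' + (dl s * dL + dr s * dR) ≤⟨ +-monoʳ-≤ E' paid≤ ⟩
        E' + (n * dL + p * dR) ∎)
        where open ≤-Reasoning
      root : Fin n
      root = proj₁ (Σ-pos (degL (A s) (B s)) survivors)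
      root-edge : ∃ λ w → T (restrict (A s) (B s) root w)
      root-edge with Σ-pos (λ w → ind (restrict (A s) (B s) root w)) (proj₂ (Σ-pos (degL (A s) (B s)) survivors))
      ... | w , pos = w , ind-pos _ pos

    prune-from : ∀ fuel → State fuel → n * dL + p * dR < edgeCount R → MinDegreeSubgraph R dL dR
    prune-from fuel s dense with any? (λ u → T? (A s u) ×-dec (degL (A s) (B s) u <? dL))
                               | any? (λ w → T? (B s w) ×-dec (degR (A s) (B s) w <? dR))
    prune-from zero s dense | yes (u , u∈A , _) | _ = ⊥-elim (emptyL s u u∈A)
    prune-from (suc f) s dense | yes (u , u∈A , low) | _ = prune-from f (deleteLeft s u u∈A low) dense
    prune-from zero s dense | no _ | yes (w , w∈B , _) = ⊥-elim (emptyR s w w∈B)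
    prune-from (suc f) s dense | no _ | yes (w , w∈B , low) = prune-from f (deleteRight s w w∈B low) dense
    prune-from fuel s dense | no noL | no noR =
      finish s dense (λ u t → ≮⇒≥ (λ lt → noL (u , t , lt))) (λ w t → ≮⇒≥ (λ lt → noR (w , t , lt)))

    prune : n * dL + p * dR < edgeCount R → MinDegreeSubgraph R dL dR
    prune = prune-from (n + p) initial

-- The key fact is the greedy extension step: a nonempty set V of left
-- vertices can be extended by a new vertex u with |N(V ∪ u)| ≥ |N(V)|·(dR − |V|)/n,
-- because every common neighbour of V has ≥ dR − |V| neighbours outside V.
module CommonNeighbourhoods where

  open import Data.Nat using (ℕ; zero; suc; _+_; _*_; _∸_; _≤_; _<_; z≤n; s≤s)
  open import Data.Nat.Properties
  open import Data.Bool using (Bool; true; false; not; _∧_; _∨_; T)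
  open import Data.Fin using (Fin)
  open import Data.Fin.Properties using () renaming (_≟_ to _≟F_)
  open import Data.List using (List; []; _∷_; length)
  open import Data.Product using (Σ; ∃; _×_; _,_)
  open import Data.Unit using (⊤)
  open import Relation.Nullary using (does; yes; no)
  open import Relation.Binary.PropositionalEquality
  open import Data.Empty using (⊥; ⊥-elim)
  open import Function using (_∘_)
  open FinSum
  open Pruning

  memb : ∀ {n} → Fin n → List (Fin n) → Bool
  memb u [] = false
  memb u (x ∷ U) = does (u ≟F x) ∨ memb u U

  distinct : ∀ {n} → List (Fin n) → Set
  distinct [] = ⊤
  distinct (x ∷ U) = T (not (memb x U)) × distinct U

  notT : ∀ {b} → T (not b) → T b → ⊥
  notT {false} _ ()

  size-memb : ∀ {n} (U : List (Fin n)) → size (λ u → memb u U) ≤ length U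
  size-memb {n} [] = ≤-reflexive (Σ-0 {n})
  size-memb {n} (x ∷ U) = begin
    size (λ u → does (u ≟F x) ∨ memb u U)           ≤⟨ Σ-mono (λ u → ind-∨ (does (u ≟F x)) (memb u U)) ⟩
    Σf (λ u → ind (does (u ≟F x)) + ind (memb u U)) ≡⟨ Σ-+ (λ u → ind (does (u ≟F x))) (λ u → ind (memb u U)) ⟩
    size (λ u → does (u ≟F x)) + size (λ u → memb u U) ≤⟨ +-mono-≤ singleton (size-memb U) ⟩
    suc (length U) ∎
    where
    open ≤-Reasoning
    ind-∨ : ∀ a b → ind (a ∨ b) ≤ ind a + ind b
    ind-∨ true b = s≤s z≤n
    ind-∨ false b = ≤-refl
    not-x : ∀ u → ind (neq u x) * ind (does (u ≟F x)) ≡ 0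
    not-x u with u ≟F x
    ... | yes _ = refl
    ... | no _ = refl
    singleton : size (λ u → does (u ≟F x)) ≤ 1
    singleton = subst (_≤ 1) (sym (Σ-split (λ u → ind (does (u ≟F x))) x))
      (+-mono-≤ (ind≤1 (does (x ≟F x))) (≤-reflexive (trans (Σ-cong not-x) (Σ-0 {n}))))

  size-outside : ∀ {n} (U : List (Fin n)) (c : Fin n → Bool) →
    size c ≤ length U + Σf (λ u → ind (not (memb u U)) * ind (c u))
  size-outside U c = ≤-trans (Σ-mono split)
    (≤-trans (≤-reflexive (Σ-+ (λ u → ind (memb u U)) (λ u → ind (not (memb u U)) * ind (c u))))
             (+-monoˡ-≤ _ (size-memb U)))
    where
    split : ∀ u → ind (c u) ≤ ind (memb u U) + ind (not (memb u U)) * ind (c u)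
    split u with memb u U
    ... | true = ind≤1 (c u)
    ... | false = ≤-reflexive (sym (+-identityʳ _))

  choose : ∀ {p} (c : Fin p → Bool) k → k ≤ size c →
    Σ (List (Fin p)) λ W → length W ≡ k × distinct W × (∀ w → T (memb w W) → T (c w))
  choose c zero h = [] , refl , _ , λ w ()
  choose c (suc k) h with choose c k (≤-trans (n≤1+n k) h)
  ... | W , lenW , distinctW , W⊆c with Σ-pos (λ w → ind (not (memb w W)) * ind (c w))
          (+-cancelˡ-≤ k 1 _ (≤-trans (≤-reflexive (+-comm k 1))
            (≤-trans h (≤-trans (size-outside W c) (≤-reflexive (cong (_+ _) lenW))))))
  ... | w , pos = w ∷ W , cong suc lenW , (fresh (memb w W) (c w) pos , distinctW) , W'⊆c
    where
    fresh : ∀ b a → 0 < ind (not b) * ind a → T (not b)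
    fresh false a _ = _
    inside : ∀ b a → 0 < ind (not b) * ind a → T a
    inside false true _ = _
    inside false false ()
    W'⊆c : ∀ w' → T (memb w' (w ∷ W)) → T (c w')
    W'⊆c w' t with w' ≟F w
    ... | yes refl = inside (memb w W) (c w) pos
    ... | no _ = W⊆c w' t

  module _ {n p : ℕ} {R : Fin n → Fin p → Bool} {dL dR : ℕ} (P : MinDegreeSubgraph R dL dR) where
    open MinDegreeSubgraph P

    common : List (Fin n) → Fin p → Bool
    common [] w = true
    common (u ∷ U) w = R' u w ∧ common U w

    N : List (Fin n) → ℕ
    N U = size (common U)

    common-all : ∀ U w → T (common U w) → ∀ u → T (memb u U) → T (R' u w)
    common-all (x ∷ U) w t u m with u ≟F x
    ... | yes refl = T∧₁ {R' x w} t
    ... | no _ = common-all U w (T∧₂ {R' x w} t) u m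

    ind-∧true : ∀ b → ind (b ∧ true) ≡ ind b
    ind-∧true true = refl
    ind-∧true false = refl

    root-N : dL ≤ N (root ∷ [])
    root-N = ≤-trans root-degree (≤-reflexive (Σ-cong (λ w → sym (ind-∧true (R' root w)))))

    -- Double counting: the new vertices u ∉ V, weighted by N(u ∷ V), count each
    -- common neighbour of V at least dR − |V| times.
    extension-count : ∀ V → (∃ λ x → T (memb x V)) →
      N V * (dR ∸ length V) ≤ Σf (λ u → ind (not (memb u V)) * N (u ∷ V))
    extension-count V (x , x∈V) = begin
      N V * (dR ∸ L)                                            ≡⟨ sym (Σ-*ʳ (λ w → ind (common V w)) (dR ∸ L)) ⟩
      Σf (λ w → ind (common V w) * (dR ∸ L))                    ≤⟨ Σ-mono per-neighbour ⟩
      Σf (λ w → Σf (λ u → ind (not (memb u V)) * ind (R' u w ∧ common V w)))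
        ≡⟨ sym (Σ-swap (λ u w → ind (not (memb u V)) * ind (R' u w ∧ common V w))) ⟩
      Σf (λ u → Σf (λ w → ind (not (memb u V)) * ind (R' u w ∧ common V w)))
        ≡⟨ Σ-cong (λ u → Σ-*ˡ {p} (ind (not (memb u V))) (λ w → ind (R' u w ∧ common V w))) ⟩
      Σf (λ u → ind (not (memb u V)) * N (u ∷ V)) ∎
      where
      open ≤-Reasoning
      L : ℕ
      L = length V
      per-neighbour : ∀ w → ind (common V w) * (dR ∸ L) ≤ Σf (λ u → ind (not (memb u V)) * ind (R' u w ∧ common V w))
      per-neighbour w with common V w in eq
      ... | false = z≤n
      ... | true = ≤-trans (≤-reflexive (+-identityʳ _)) (m≤n+o⇒m∸n≤o dR L (begin
            dR                                                 ≤⟨ right-degree x w (common-all V w (subst T (sym eq) _) x x∈V) ⟩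
            size (λ u → R' u w)                               ≤⟨ size-outside V (λ u → R' u w) ⟩
            L + Σf (λ u → ind (not (memb u V)) * ind (R' u w))
              ≡⟨ cong (L +_) (Σ-cong (λ u → cong (ind (not (memb u V)) *_) (sym (ind-∧true (R' u w))))) ⟩
            L + Σf (λ u → ind (not (memb u V)) * ind (R' u w ∧ true)) ∎))

    extend : ∀ V → (∃ λ x → T (memb x V)) → 0 < N V * (dR ∸ length V) →
      ∃ λ u → T (not (memb u V)) × N V * (dR ∸ length V) ≤ n * N (u ∷ V)
    extend V (x , x∈V) pos with average (λ u → ind (not (memb u V)) * N (u ∷ V)) x | extension-count V (x , x∈V)
    ... | u , avg | count with memb u V in eq
    ...   | true = ⊥-elim (<-irrefl refl (≤-trans pos (≤-trans count (≤-trans avg (≤-reflexive (*-zeroʳ n))))))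
    ...   | false = u , subst (T ∘ not) (sym eq) _ , ≤-trans count (≤-trans avg (≤-reflexive (cong (n *_) (+-identityʳ _))))

module Bicliques where

  open import Data.Nat using (ℕ; zero; suc; _+_; _*_; _∸_; _^_; _≤_; _<_; z≤n; s≤s; >-nonZero)
  open import Data.Nat.Properties
  open import Data.Bool using (Bool; true; not; _∧_; T)
  open import Data.Fin using (Fin)
  open import Data.Fin.Properties using () renaming (_≟_ to _≟F_)
  open import Data.List using (List; []; _∷_; length)
  open import Data.Product using (Σ; ∃; ∃₂; _×_; _,_; proj₁; proj₂)
  open import Relation.Nullary using (yes; no)
  open import Relation.Binary.PropositionalEquality
  open import Data.Empty using (⊥-elim)
  open FinSum
  open Pruning
  open CommonNeighbourhoods
  import Algebra.Properties.CommutativeSemigroup *-commutativeSemigroup as ×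

  positive-factor : ∀ a b → 0 < a * b → 0 < b
  positive-factor a zero ab>0 = ⊥-elim (n≮0 (subst (0 <_) (*-zeroʳ a) ab>0))
  positive-factor a (suc b) _ = s≤s z≤n

  memb-head : ∀ {n} (x : Fin n) U → T (memb x (x ∷ U))
  memb-head x U with x ≟F x
  ... | yes _ = _
  ... | no ne = ⊥-elim (ne refl)

  commonPair : ∀ {n q} (R : Fin n → Fin q → Bool) r → 2 ≤ r → n * (n * r) + q * r < edgeCount R →
    ∃₂ λ t₁ t₂ → t₁ ≢ t₂ × r * (r ∸ 1) ≤ size (λ z → R t₁ z ∧ R t₂ z)
  commonPair {zero} R r r≥2 dense = ⊥-elim (n≮0 dense)
  commonPair {suc n'} R r r≥2 dense = t₁ , t₂ , t₁≢t₂ , common≥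
    where
    n : ℕ
    n = suc n'
    P : MinDegreeSubgraph R (n * r) r
    P = prune R (n * r) r dense
    open MinDegreeSubgraph P
    t₁ : Fin n
    t₁ = root
    pos : 0 < N P (t₁ ∷ []) * (r ∸ 1)
    pos = *-mono-≤ (≤-trans (*-mono-≤ (s≤s (z≤n {n'})) (≤-trans (s≤s z≤n) r≥2)) (root-N P)) (m<n⇒0<n∸m r≥2)
    step : ∃ λ u → T (not (memb u (t₁ ∷ []))) × N P (t₁ ∷ []) * (r ∸ 1) ≤ n * N P (u ∷ t₁ ∷ [])
    step = extend P (t₁ ∷ []) (t₁ , memb-head t₁ []) pos
    t₂ : Fin n
    t₂ = proj₁ step
    t₁≢t₂ : t₁ ≢ t₂
    t₁≢t₂ eq = notT (proj₁ (proj₂ step)) (subst (λ t → T (memb t (t₁ ∷ []))) eq (memb-head t₁ []))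
    both : ∀ z → T (R' t₂ z ∧ (R' t₁ z ∧ true)) → T (R t₁ z ∧ R t₂ z)
    both z t = T∧ {R t₁ z} (R'⊆R t₁ z (T∧₁ {R' t₁ z} (T∧₂ {R' t₂ z} t))) (R'⊆R t₂ z (T∧₁ {R' t₂ z} t))
    common≥ : r * (r ∸ 1) ≤ size (λ z → R t₁ z ∧ R t₂ z)
    common≥ = ≤-trans (*-cancelˡ-≤ n (begin
      n * (r * (r ∸ 1))        ≡⟨ sym (*-assoc n r (r ∸ 1)) ⟩
      n * r * (r ∸ 1)          ≤⟨ *-monoˡ-≤ (r ∸ 1) (root-N P) ⟩
      N P (t₁ ∷ []) * (r ∸ 1)  ≤⟨ proj₂ (proj₂ step) ⟩
      n * N P (t₂ ∷ t₁ ∷ [])   ∎))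
      (Σ-mono (λ z → ind-mono (both z)))
      where open ≤-Reasoning

  record Biclique {n p : ℕ} (G : Fin n → Fin p → Bool) (k : ℕ) : Set where
    field
      U : List (Fin n)
      W : List (Fin p)
      |U| : length U ≡ k
      |W| : length W ≡ k
      U-distinct : distinct U
      W-distinct : distinct W
      complete : ∀ u w → T (memb u U) → T (memb w W) → T (G u w)

  -- While
  -- |U| ≤ d/2, every common neighbour keeps ≥ d/2 neighbours outside U, so a
  -- step loses at most a factor 2n/d ≤ Q.
  module Growth {n p} {G : Fin n → Fin p → Bool} {d : ℕ} (P : MinDegreeSubgraph G d d)
                (Q s : ℕ) (ratio : n + n ≤ Q * d) (2s+2≤d : suc s + suc s ≤ d) where
    open MinDegreeSubgraph P

    Grown : ℕ → Set
    Grown i = Σ (List (Fin n)) λ U → length U ≡ suc i × distinct U × d ≤ Q ^ i * N P U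

    half : ∀ j → j ≤ suc s → d ≤ (d ∸ j) + (d ∸ j)
    half j j≤ = begin
      d                     ≡⟨ sym (m∸n+n≡m (≤-trans (m≤m+n j j) j+j≤d)) ⟩
      (d ∸ j) + j           ≤⟨ +-monoʳ-≤ (d ∸ j) (m+n≤o⇒m≤o∸n j j+j≤d) ⟩
      (d ∸ j) + (d ∸ j)     ∎
      where
      open ≤-Reasoning
      j+j≤d : j + j ≤ d
      j+j≤d = ≤-trans (+-mono-≤ j≤ j≤) 2s+2≤d

    grow : ∀ i → suc i ≤ s → Grown i → Grown (suc i)
    grow i i<s (x ∷ U' , refl , distinctU , inv) = u ∷ V , refl , (proj₁ (proj₂ step) , distinctU) , inv'
      where
      V : List (Fin n)
      V = x ∷ U'
      pos : 0 < N P V * (d ∸ suc i)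
      pos = *-mono-≤ (positive-factor (Q ^ i) (N P V) (≤-trans (≤-trans (s≤s z≤n) 2s+2≤d) inv))
                     (m<n⇒0<n∸m (≤-trans (s≤s (≤-trans i<s (m≤m+n s (suc s)))) 2s+2≤d))
      step : ∃ λ u → T (not (memb u V)) × N P V * (d ∸ suc i) ≤ n * N P (u ∷ V)
      step = extend P V (x , memb-head x U') pos
      u : Fin n
      u = proj₁ step
      shrink : N P V ≤ Q * N P (u ∷ V)
      shrink = *-cancelʳ-≤ (N P V) (Q * N P (u ∷ V)) d {{>-nonZero (≤-trans (s≤s z≤n) 2s+2≤d)}} (begin
        N P V * d                                       ≤⟨ *-monoʳ-≤ (N P V) (half (suc i) (≤-trans i<s (n≤1+n s))) ⟩
        N P V * ((d ∸ suc i) + (d ∸ suc i))             ≡⟨ *-distribˡ-+ (N P V) (d ∸ suc i) (d ∸ suc i) ⟩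
        N P V * (d ∸ suc i) + N P V * (d ∸ suc i)       ≤⟨ +-mono-≤ (proj₂ (proj₂ step)) (proj₂ (proj₂ step)) ⟩
        n * N P (u ∷ V) + n * N P (u ∷ V)               ≡⟨ sym (*-distribʳ-+ (N P (u ∷ V)) n n) ⟩
        (n + n) * N P (u ∷ V)                           ≤⟨ *-monoˡ-≤ (N P (u ∷ V)) ratio ⟩
        Q * d * N P (u ∷ V)                             ≡⟨ ×.xy∙z≈xz∙y Q d (N P (u ∷ V)) ⟩
        Q * N P (u ∷ V) * d                             ∎)
        where open ≤-Reasoning
      inv' : d ≤ Q ^ suc i * N P (u ∷ V)
      inv' = ≤-trans inv (≤-trans (*-monoʳ-≤ (Q ^ i) shrink) (≤-reflexive (×.x∙yz≈yx∙z (Q ^ i) Q (N P (u ∷ V)))))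

    grownUpTo : ∀ i → i ≤ s → Grown i
    grownUpTo zero _ = root ∷ [] , refl , (_ , _) , subst (d ≤_) (sym (+-identityʳ _)) (root-N P)
    grownUpTo (suc i) i<s = grow i i<s (grownUpTo i (≤-trans (n≤1+n i) i<s))

  -- If G ⊆ Fin n × Fin p has more than n·d + p·d edges, where 2n ≤ Q·d and
  -- d > Q^s·(s + 1) + 2(s + 1), then G contains K_{s+1,s+1}: grow U to s + 1
  -- vertices; then N(U) ≥ s + 1 and W is chosen inside N(U).
  biclique : ∀ {n p} (G : Fin n → Fin p → Bool) d Q s →
    n * d + p * d < edgeCount G → n + n ≤ Q * d → Q ^ s * suc s + 2 * suc s < d →
    Biclique G (suc s)
  biclique {n} {p} G d Q s dense ratio large = record
    { U = U ; W = proj₁ chosen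
    ; |U| = |U| ; |W| = proj₁ (proj₂ chosen)
    ; U-distinct = U-distinct ; W-distinct = proj₁ (proj₂ (proj₂ chosen))
    ; complete = λ u w u∈U w∈W → R'⊆R u w (common-all P U w (proj₂ (proj₂ (proj₂ chosen)) w w∈W) u u∈U)
    }
    where
    P : MinDegreeSubgraph G d d
    P = prune G d d dense
    open MinDegreeSubgraph P
    2s+2≤d : suc s + suc s ≤ d
    2s+2≤d = ≤-trans (≤-trans (≤-reflexive (cong (suc s +_) (sym (+-identityʳ (suc s))))) (m≤n+m _ _)) (<⇒≤ large)
    open Growth P Q s ratio 2s+2≤d using (grownUpTo)
    U : List (Fin n)
    U = proj₁ (grownUpTo s ≤-refl)
    |U| : length U ≡ suc s
    |U| = proj₁ (proj₂ (grownUpTo s ≤-refl))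
    U-distinct : distinct U
    U-distinct = proj₁ (proj₂ (proj₂ (grownUpTo s ≤-refl)))
    -- N(U) ≤ s would give d ≤ Q^s·s, contradicting the size of d.
    large-N : suc s ≤ N P U
    large-N = ≮⇒≥ λ small → <-irrefl refl (begin-strict
      d                          ≤⟨ proj₂ (proj₂ (proj₂ (grownUpTo s ≤-refl))) ⟩
      Q ^ s * N P U              ≤⟨ *-monoʳ-≤ (Q ^ s) (≤-trans (≤-pred small) (n≤1+n s)) ⟩
      Q ^ s * suc s              ≤⟨ m≤m+n _ _ ⟩
      Q ^ s * suc s + 2 * suc s  <⟨ large ⟩
      d                          ∎)
      where open ≤-Reasoning
    chosen : Σ (List (Fin p)) λ W → length W ≡ suc s × distinct W × (∀ w → T (memb w W) → T (common P U w))
    chosen = choose (common P U) (suc s) large-N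

-- An edge S meeting T can be written
-- as {t, a, b} with t ∈ T and t, a, b distinct, so the number of edges meeting
-- T is at most the number of such "admissible" ordered triples (t, a, b).
module OrderedTriples where

  open import Data.Nat using (ℕ; zero; suc; _+_; _*_; _≤_; z≤n) renaming (_≟_ to _≟ℕ_)
  open import Data.Nat.Properties
  open import Data.Bool using (Bool; true; false; T)
  open import Data.Bool.Properties using (T?) renaming (_≟_ to _≟B_)
  open import Data.Fin using (Fin; zero; suc)
  open import Data.Fin.Properties using () renaming (_≟_ to _≟F_; suc-injective to Fin-suc-injective)
  open import Data.Fin.Subset using (Subset; ⁅_⁆; _∪_; _∩_; ∣_∣; Nonempty; _∈_; _∉_; _⊆_; outside)
  open import Data.Fin.Subset.Properties using (x∈p∩q⁻; x∈p∪q⁻; x∈p∪q⁺; x∈⁅x⁆; x∈⁅y⁆⇒x≡y; ⊆-antisym; _∈?_)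
  open import Data.Vec using ([]; _∷_; here; there)
  open import Data.Vec.Properties using (≡-dec)
  open import Data.List using (List; []; _∷_; map; filter; length; _++_)
  open import Data.List.Properties using (map-++; map-∘)
  open import Data.Nat.ListAction using (sum)
  open import Data.Nat.ListAction.Properties using (sum-++)
  open import Data.Product using (Σ; ∃; _×_; _,_; proj₁; proj₂)
  open import Data.Sum using (_⊎_; inj₁; inj₂)
  open import Relation.Nullary using (Dec; does; yes; no)
  open import Relation.Nullary.Decidable using (⌊_⌋; map′; ¬?; _×-dec_; fromWitness; dec-true)
  open import Relation.Binary.PropositionalEquality
  open import Data.Empty using (⊥-elim)
  open import Defs
  open FinSum

  remove : ∀ {n} → Subset n → Fin n → Subset n
  remove (b ∷ s) zero = outside ∷ s
  remove (b ∷ s) (suc i) = b ∷ remove s i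

  remove-suc : ∀ {n} {S : Subset n} {x} → x ∈ S → ∣ S ∣ ≡ suc ∣ remove S x ∣
  remove-suc {S = .true ∷ s} here = refl
  remove-suc {S = true ∷ s} (there p) = cong suc (remove-suc p)
  remove-suc {S = false ∷ s} (there p) = remove-suc p

  remove-size : ∀ {n k} {S : Subset n} {x} → x ∈ S → ∣ S ∣ ≡ suc k → ∣ remove S x ∣ ≡ k
  remove-size x∈S e = suc-injective (trans (sym (remove-suc x∈S)) e)

  remove⁻ : ∀ {n} {S : Subset n} {x y} → y ∈ remove S x → y ∈ S × y ≢ x
  remove⁻ {S = b ∷ s} {zero} {suc y} (there p) = there p , λ ()
  remove⁻ {S = b ∷ s} {suc x} {zero} here = here , λ ()
  remove⁻ {S = b ∷ s} {suc x} {suc y} (there p) with remove⁻ p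
  ... | q , ne = there q , λ e → ne (Fin-suc-injective e)

  remove⁺ : ∀ {n} {S : Subset n} {x y} → y ∈ S → y ≢ x → y ∈ remove S x
  remove⁺ {x = zero} here ne = ⊥-elim (ne refl)
  remove⁺ {x = suc x} here ne = here
  remove⁺ {x = zero} (there p) ne = there p
  remove⁺ {x = suc x} (there p) ne = there (remove⁺ p (λ e → ne (cong suc e)))

  size-zero : ∀ {n} {S : Subset n} {y} → ∣ S ∣ ≡ 0 → y ∉ S
  size-zero {S = true ∷ s} () here
  size-zero {S = true ∷ s} () (there p)
  size-zero {S = false ∷ s} e (there p) = size-zero e p

  size-suc : ∀ {n} {S : Subset n} {k} → ∣ S ∣ ≡ suc k → ∃ λ y → y ∈ S
  size-suc {S = true ∷ s} e = zero , here
  size-suc {S = false ∷ s} e with size-suc {S = s} e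
  ... | y , p = suc y , there p

  triple⁻ : ∀ {n} {x a b y : Fin n} → y ∈ triple x a b → y ≡ x ⊎ y ≡ a ⊎ y ≡ b
  triple⁻ {x = x} {a} {b} m with x∈p∪q⁻ ⁅ x ⁆ (⁅ a ⁆ ∪ ⁅ b ⁆) m
  ... | inj₁ p = inj₁ (x∈⁅y⁆⇒x≡y x p)
  ... | inj₂ q with x∈p∪q⁻ ⁅ a ⁆ ⁅ b ⁆ q
  ...   | inj₁ p = inj₂ (inj₁ (x∈⁅y⁆⇒x≡y a p))
  ...   | inj₂ p = inj₂ (inj₂ (x∈⁅y⁆⇒x≡y b p))

  triple⁺ : ∀ {n} {x a b y : Fin n} → y ≡ x ⊎ y ≡ a ⊎ y ≡ b → y ∈ triple x a b
  triple⁺ {x = x} (inj₁ refl) = x∈p∪q⁺ (inj₁ (x∈⁅x⁆ x))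
  triple⁺ {a = a} (inj₂ (inj₁ refl)) = x∈p∪q⁺ (inj₂ (x∈p∪q⁺ (inj₁ (x∈⁅x⁆ a))))
  triple⁺ {b = b} (inj₂ (inj₂ refl)) = x∈p∪q⁺ (inj₂ (x∈p∪q⁺ (inj₂ (x∈⁅x⁆ b))))

  triple-swap : ∀ {n} (x a b : Fin n) → triple x a b ≡ triple x b a
  triple-swap x a b = ⊆-antisym (λ m → triple⁺ (swap (triple⁻ m))) (λ m → triple⁺ (swap (triple⁻ m)))
    where
    swap : ∀ {y : Fin _} {a b} → y ≡ x ⊎ y ≡ a ⊎ y ≡ b → y ≡ x ⊎ y ≡ b ⊎ y ≡ a
    swap (inj₁ e) = inj₁ e
    swap (inj₂ (inj₁ e)) = inj₂ (inj₂ e)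
    swap (inj₂ (inj₂ e)) = inj₂ (inj₁ e)

  three-elements : ∀ {n} {S : Subset n} {x} → x ∈ S → ∣ S ∣ ≡ 3 →
    Σ (Fin n) λ a → Σ (Fin n) λ b → x ≢ a × x ≢ b × a ≢ b × S ≡ triple x a b
  three-elements {n} {S} {x} x∈S |S|≡3 with size-suc {S = remove S x} |S₁|≡2
    where
    |S₁|≡2 : ∣ remove S x ∣ ≡ 2
    |S₁|≡2 = remove-size x∈S |S|≡3
  ... | a , a∈S₁ with size-suc {S = remove (remove S x) a} (remove-size a∈S₁ (remove-size x∈S |S|≡3))
  ... | b , b∈S₂ = a , b , x≢a , x≢b , a≢b , ⊆-antisym S⊆ ⊆S
    where
    x≢a : x ≢ a
    x≢a e = proj₂ (remove⁻ a∈S₁) (sym e)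
    x≢b : x ≢ b
    x≢b e = proj₂ (remove⁻ (proj₁ (remove⁻ b∈S₂))) (sym e)
    a≢b : a ≢ b
    a≢b e = proj₂ (remove⁻ b∈S₂) (sym e)
    |S₃|≡0 : ∣ remove (remove (remove S x) a) b ∣ ≡ 0
    |S₃|≡0 = remove-size b∈S₂ (remove-size a∈S₁ (remove-size x∈S |S|≡3))
    S⊆ : S ⊆ triple x a b
    S⊆ {y} y∈S with y ≟F x | y ≟F a | y ≟F b
    ... | yes e | _ | _ = triple⁺ (inj₁ e)
    ... | no _ | yes e | _ = triple⁺ (inj₂ (inj₁ e))
    ... | no _ | no _ | yes e = triple⁺ (inj₂ (inj₂ e))
    ... | no y≢x | no y≢a | no y≢b = ⊥-elim (size-zero |S₃|≡0 (remove⁺ (remove⁺ (remove⁺ y∈S y≢x) y≢a) y≢b))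
    ⊆S : triple x a b ⊆ S
    ⊆S m with triple⁻ m
    ... | inj₁ refl = x∈S
    ... | inj₂ (inj₁ refl) = proj₁ (remove⁻ a∈S₁)
    ... | inj₂ (inj₂ refl) = proj₁ (remove⁻ (proj₁ (remove⁻ b∈S₂)))

  module _ {n : ℕ} (H : 3Graph n) (TT : Subset n) where

    record Admissible (t a b : Fin n) : Set where
      field
        t∈T : t ∈ TT
        t≢a : t ≢ a
        t≢b : t ≢ b
        a≢b : a ≢ b
        edge : IsEdge H (triple t a b)

    admissible? : ∀ t a b → Dec (Admissible t a b)
    admissible? t a b = map′ (λ (p , q , r , s , e) → record { t∈T = p ; t≢a = q ; t≢b = r ; a≢b = s ; edge = e })
      (λ A → Admissible.t∈T A , Admissible.t≢a A , Admissible.t≢b A , Admissible.a≢b A , Admissible.edge A)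
      ((t ∈? TT) ×-dec ¬? (t ≟F a) ×-dec ¬? (t ≟F b) ×-dec ¬? (a ≟F b) ×-dec
       ((∣ triple t a b ∣ ≟ℕ 3) ×-dec T? (H (triple t a b))))

    admissible : Fin n → Fin n → Fin n → Bool
    admissible t a b = ⌊ admissible? t a b ⌋

    admissible-swap : ∀ {t a b} → Admissible t a b → Admissible t b a
    admissible-swap A = record { t∈T = t∈T ; t≢a = t≢b ; t≢b = t≢a ; a≢b = λ e → a≢b (sym e)
                               ; edge = subst (IsEdge H) (triple-swap _ _ _) edge }
      where open Admissible A

    admissibleCount : ℕ
    admissibleCount = Σf (λ t → Σf (λ a → Σf (λ b → ind (admissible t a b))))

  length-filter≤ : ∀ {A : Set} {P : A → Set} (P? : (x : A) → Dec (P x)) (g : A → ℕ) xs →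
    (∀ x → P x → 1 ≤ g x) → length (filter P? xs) ≤ sum (map g xs)
  length-filter≤ P? g [] h = z≤n
  length-filter≤ P? g (x ∷ xs) h with P? x
  ... | yes p = +-mono-≤ (h x p) (length-filter≤ P? g xs h)
  ... | no _ = ≤-trans (length-filter≤ P? g xs h) (m≤n+m _ (g x))

  sum-map-Σ : ∀ {A : Set} {m} (xs : List A) (f : Fin m → A → ℕ) →
    sum (map (λ S → Σf (λ i → f i S)) xs) ≡ Σf (λ i → sum (map (f i) xs))
  sum-map-Σ {m = m} [] f = sym (Σ-0 {m})
  sum-map-Σ (x ∷ xs) f = trans (cong (Σf (λ i → f i x) +_) (sum-map-Σ xs f)) (sym (Σ-+ (λ i → f i x) (λ i → sum (map (f i) xs))))

  sum-map-*ˡ : ∀ {A : Set} (xs : List A) c (h : A → ℕ) → sum (map (λ S → c * h S) xs) ≡ c * sum (map h xs)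
  sum-map-*ˡ [] c h = sym (*-zeroʳ c)
  sum-map-*ˡ (x ∷ xs) c h = trans (cong (c * h x +_) (sum-map-*ˡ xs c h)) (sym (*-distribˡ-+ c (h x) _))

  sum-map-0 : ∀ {A : Set} (xs : List A) → sum (map (λ _ → 0) xs) ≡ 0
  sum-map-0 [] = refl
  sum-map-0 (x ∷ xs) = sum-map-0 xs

  sum-map-++ : ∀ {A : Set} (f : A → ℕ) xs ys → sum (map f (xs ++ ys)) ≡ sum (map f xs) + sum (map f ys)
  sum-map-++ f xs ys = trans (cong sum (map-++ f xs ys)) (sum-++ (map f xs) (map f ys))

  same : ∀ {n} → Subset n → Subset n → Bool
  same s S = does (≡-dec _≟B_ s S)

  occurs-once : ∀ n (s : Subset n) → sum (map (λ S → ind (same s S)) (allSubsets n)) ≤ 1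
  occurs-once zero [] = ≤-refl
  occurs-once (suc n) (b ∷ s)
    rewrite sum-map-++ (λ S → ind (same (b ∷ s) S)) (map (true ∷_) (allSubsets n)) (map (false ∷_) (allSubsets n))
          | sym (map-∘ {g = λ S → ind (same (b ∷ s) S)} {f = true ∷_} (allSubsets n))
          | sym (map-∘ {g = λ S → ind (same (b ∷ s) S)} {f = false ∷_} (allSubsets n)) with b
  ... | true rewrite sum-map-0 (allSubsets n) = ≤-trans (≤-reflexive (+-identityʳ _)) (occurs-once n s)
  ... | false rewrite sum-map-0 (allSubsets n) = occurs-once n s

  -- The number of edges meeting T is at most the number of admissible triples:
  -- weight each subset S by the number of admissible (t, a, b) with {t, a, b} = S.
  edgesMeeting≤admissible : ∀ {n} (H : 3Graph n) (TT : Subset n) → edgesMeeting H TT ≤ admissibleCount H TT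
  edgesMeeting≤admissible {n} H TT = begin
    edgesMeeting H TT          ≤⟨ length-filter≤ _ weight (allSubsets n) hit ⟩
    sum (map weight (allSubsets n)) ≡⟨ regroup ⟩
    Σf (λ t → Σf (λ a → Σf (λ b → ind (q t a b) * sum (map (λ S → ind (same (triple t a b) S)) (allSubsets n)))))
      ≤⟨ Σ-mono (λ t → Σ-mono (λ a → Σ-mono (λ b →
           ≤-trans (*-monoʳ-≤ (ind (q t a b)) (occurs-once n (triple t a b))) (≤-reflexive (*-identityʳ _))))) ⟩
    admissibleCount H TT      ∎
    where
    open ≤-Reasoning
    q = admissible H TT
    weight : Subset n → ℕ
    weight S = Σf (λ t → Σf (λ a → Σf (λ b → ind (q t a b) * ind (same (triple t a b) S))))
    regroup : sum (map weight (allSubsets n)) ≡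
              Σf (λ t → Σf (λ a → Σf (λ b → ind (q t a b) * sum (map (λ S → ind (same (triple t a b) S)) (allSubsets n)))))
    regroup = trans (sum-map-Σ (allSubsets n) (λ t S → Σf (λ a → Σf (λ b → ind (q t a b) * ind (same (triple t a b) S)))))
      (Σ-cong λ t → trans (sum-map-Σ (allSubsets n) (λ a S → Σf (λ b → ind (q t a b) * ind (same (triple t a b) S))))
      (Σ-cong λ a → trans (sum-map-Σ (allSubsets n) (λ b S → ind (q t a b) * ind (same (triple t a b) S)))
      (Σ-cong λ b → sum-map-*ˡ (allSubsets n) (ind (q t a b)) (λ S → ind (same (triple t a b) S)))))
    hit : ∀ S → (∣ S ∣ ≡ 3) × (T (H S) × Nonempty (S ∩ TT)) → 1 ≤ weight S
    hit S (|S|≡3 , HS , (x , x∈S∩T)) with x∈p∩q⁻ S TT x∈S∩T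
    ... | x∈S , x∈T with three-elements x∈S |S|≡3
    ... | a , b , x≢a , x≢b , a≢b , S≡xab = begin
      1                                              ≡⟨ sym (cong₂ _*_ admissible-1 same-1) ⟩
      ind (q x a b) * ind (same (triple x a b) S)    ≤⟨ Σ-≥pt (term x a) b ⟩
      Σf (term x a)                                  ≤⟨ Σ-≥pt (λ a' → Σf (term x a')) a ⟩
      Σf (λ a' → Σf (term x a'))                     ≤⟨ Σ-≥pt (λ t → Σf (λ a' → Σf (term t a'))) x ⟩
      weight S ∎
      where
      term : Fin n → Fin n → Fin n → ℕ
      term t a' b' = ind (q t a' b') * ind (same (triple t a' b') S)
      admissible-xab : Admissible H TT x a b
      admissible-xab = record { t∈T = x∈T ; t≢a = x≢a ; t≢b = x≢b ; a≢b = a≢b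
                              ; edge = subst (λ S → (∣ S ∣ ≡ 3) × T (H S)) S≡xab (|S|≡3 , HS) }
      admissible-1 : ind (q x a b) ≡ 1
      admissible-1 = ind-T (fromWitness {a? = admissible? H TT x a b} admissible-xab)
      same-1 : ind (same (triple x a b) S) ≡ 1
      same-1 = cong ind (dec-true (≡-dec _≟B_ (triple x a b) S) (sym S≡xab))

-- Position j of the cycle holds u_{j/2} for even
-- j and w_{(j-1)/2} for odd j.
module DoublePyramids where

  open import Data.Nat using (ℕ; zero; suc; _+_; _*_; _≤_; _<_; z≤n; s≤s)
  open import Data.Nat.Properties
  open import Data.Bool using (Bool; true; false; _∧_; _∨_; T)
  open import Data.Fin using (Fin; zero; suc; toℕ)
  open import Data.Fin.Properties using (toℕ-injective; toℕ<n) renaming (_≟_ to _≟F_)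
  open import Data.Fin.Subset using (Subset; _∈_)
  open import Data.List using (List; []; _∷_; length)
  open import Data.Product using (Σ; _×_; _,_; proj₁; proj₂)
  open import Data.Sum using (_⊎_; inj₁; inj₂)
  open import Relation.Nullary using (does)
  open import Relation.Nullary.Decidable using (toWitness)
  open import Relation.Binary.PropositionalEquality
  open import Data.Empty using (⊥-elim)
  open import Defs
  open Pruning using (T∧₁; T∧₂)
  open CommonNeighbourhoods using (memb; distinct; notT)
  open Bicliques using (Biclique; memb-head)
  open OrderedTriples

  dbl : ℕ → ℕ
  dbl zero = zero
  dbl (suc i) = suc (suc (dbl i))

  2*≡dbl : ∀ k → 2 * k ≡ dbl k
  2*≡dbl zero = refl
  2*≡dbl (suc k) = cong suc (trans (+-suc k (k + 0)) (cong suc (2*≡dbl k)))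

  parity : ∀ a → Σ ℕ λ i → a ≡ dbl i ⊎ a ≡ suc (dbl i)
  parity zero = 0 , inj₁ refl
  parity (suc a) with parity a
  ... | i , inj₁ e = i , inj₂ (cong suc e)
  ... | i , inj₂ e = suc i , inj₁ (cong suc e)

  dbl≢sdbl : ∀ i j → dbl i ≢ suc (dbl j)
  dbl≢sdbl i j e = even≢odd i j (trans (2*≡dbl i) (trans e (cong suc (sym (2*≡dbl j)))))

  dbl-<⁻ : ∀ i k → dbl i < dbl k → i < k
  dbl-<⁻ zero (suc k) _ = s≤s z≤n
  dbl-<⁻ (suc i) (suc k) (s≤s (s≤s h)) = s≤s (dbl-<⁻ i k h)

  sdbl-<⁻ : ∀ i k → suc (dbl i) < dbl k → i < k
  sdbl-<⁻ i k h = dbl-<⁻ i k (<-trans (n<1+n (dbl i)) h)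

  -- Interleaving two sequences: alt u w = u₀ w₀ u₁ w₁ …
  alt : ∀ {A : Set} → (ℕ → A) → (ℕ → A) → ℕ → A
  alt u w zero = u 0
  alt u w (suc a) = alt w (λ i → u (suc i)) a

  alt-even : ∀ {A : Set} (u w : ℕ → A) i → alt u w (dbl i) ≡ u i
  alt-even u w zero = refl
  alt-even u w (suc i) = alt-even (λ j → u (suc j)) (λ j → w (suc j)) i

  alt-odd : ∀ {A : Set} (u w : ℕ → A) i → alt u w (suc (dbl i)) ≡ w i
  alt-odd u w zero = refl
  alt-odd u w (suc i) = alt-odd (λ j → u (suc j)) (λ j → w (suc j)) i

  cnext-toℕ : ∀ {m} (i : Fin (suc m)) → (toℕ (cnext i) ≡ suc (toℕ i)) ⊎ (toℕ (cnext i) ≡ 0 × toℕ i ≡ m)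
  cnext-toℕ {zero} zero = inj₂ (refl , refl)
  cnext-toℕ {suc m} zero = inj₁ refl
  cnext-toℕ {suc m} (suc i) with cnext {m} i | cnext-toℕ {m} i
  ... | zero | inj₂ (_ , e) = inj₂ (refl , cong suc e)
  ... | suc j | inj₁ e = inj₁ (cong suc e)

  module Construction {n : ℕ} (H : 3Graph n) (TT : Subset n) {x y : Fin n} (x≢y : x ≢ y)
    (k' : ℕ) (k'≥1 : 1 ≤ k') (u w : ℕ → Fin n)
    (adj : ∀ i j → i < suc k' → j < suc k' → Admissible H TT x (u i) (w j) × Admissible H TT y (u i) (w j))
    (u-inj : ∀ i j → i < suc k' → j < suc k' → u i ≡ u j → i ≡ j)
    (w-inj : ∀ i j → i < suc k' → j < suc k' → w i ≡ w j → i ≡ j) where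

    k = suc k'

    v : Fin (2 * k) → Fin n
    v j = alt u w (toℕ j)

    bound : ∀ (j : Fin (2 * k)) → toℕ j < dbl k
    bound j = ≤-trans (toℕ<n j) (≤-reflexive (2*≡dbl k))

    Adj : Fin n → Fin n → Set
    Adj p q = Admissible H TT x p q × Admissible H TT y p q

    -- Consecutive cycle positions a, b hold a u and a w, hence are adjacent.
    consecutive : ∀ a b → a < dbl k → b < dbl k → (b ≡ suc a ⊎ (b ≡ 0 × a ≡ suc (dbl k'))) →
                  Adj (alt u w a) (alt u w b)
    consecutive a b a< b< next with parity a | parity b
    ... | i , inj₁ refl | i' , inj₂ refl rewrite alt-even u w i | alt-odd u w i' =
      adj i i' (dbl-<⁻ i k a<) (sdbl-<⁻ i' k b<)
    ... | i , inj₂ refl | i' , inj₁ refl rewrite alt-odd u w i | alt-even u w i' =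
      let (ax , ay) = adj i' i (dbl-<⁻ i' k b<) (sdbl-<⁻ i k a<) in admissible-swap H TT ax , admissible-swap H TT ay
    ... | i , inj₁ refl | i' , inj₁ refl with next
    ...   | inj₁ e = ⊥-elim (dbl≢sdbl i' i e)
    ...   | inj₂ (_ , e) = ⊥-elim (dbl≢sdbl i k' e)
    consecutive a b a< b< next | i , inj₂ refl | i' , inj₂ refl with next
    ...   | inj₁ e = ⊥-elim (dbl≢sdbl i' i (suc-injective e))
    ...   | inj₂ (() , _)

    adj-next : ∀ (j : Fin (2 * k)) → Adj (v j) (v (next j))
    adj-next j = consecutive (toℕ j) (toℕ (next j)) (bound j) (bound (next j)) step
      where
      step : toℕ (next j) ≡ suc (toℕ j) ⊎ (toℕ (next j) ≡ 0 × toℕ j ≡ suc (dbl k'))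
      step with cnext-toℕ {k' + suc (k' + 0)} j
      ... | inj₁ e = inj₁ e
      ... | inj₂ (e , e') = inj₂ (e , trans e' (suc-injective (2*≡dbl k)))

    apexes-outside : ∀ (j : Fin (2 * k)) → x ≢ v j × y ≢ v j
    apexes-outside j with parity (toℕ j) | bound j
    ... | i , inj₁ e | j< rewrite e | alt-even u w i =
      let (ax , ay) = adj i i (dbl-<⁻ i k j<) (dbl-<⁻ i k j<) in Admissible.t≢a ax , Admissible.t≢a ay
    ... | i , inj₂ e | j< rewrite e | alt-odd u w i =
      let (ax , ay) = adj i i (sdbl-<⁻ i k j<) (sdbl-<⁻ i k j<) in Admissible.t≢b ax , Admissible.t≢b ay

    alt-inj : ∀ a b → a < dbl k → b < dbl k → alt u w a ≡ alt u w b → a ≡ b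
    alt-inj a b a< b< e with parity a | parity b
    ... | i , inj₁ refl | i' , inj₁ refl rewrite alt-even u w i | alt-even u w i' =
      cong dbl (u-inj i i' (dbl-<⁻ i k a<) (dbl-<⁻ i' k b<) e)
    ... | i , inj₂ refl | i' , inj₂ refl rewrite alt-odd u w i | alt-odd u w i' =
      cong (λ z → suc (dbl z)) (w-inj i i' (sdbl-<⁻ i k a<) (sdbl-<⁻ i' k b<) e)
    ... | i , inj₁ refl | i' , inj₂ refl rewrite alt-even u w i | alt-odd u w i' =
      ⊥-elim (Admissible.a≢b (proj₁ (adj i i' (dbl-<⁻ i k a<) (sdbl-<⁻ i' k b<))) e)
    ... | i , inj₂ refl | i' , inj₁ refl rewrite alt-odd u w i | alt-even u w i' =
      ⊥-elim (Admissible.a≢b (proj₁ (adj i' i (dbl-<⁻ i' k b<) (sdbl-<⁻ i k a<))) (sym e))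

    pyramid : Σ (DoublePyramid H (2 * k)) λ P → (DoublePyramid.x P ∈ TT) × (DoublePyramid.y P ∈ TT)
    pyramid = record
      { m≥3 = ≤-trans (n≤1+n 3) (*-monoʳ-≤ 2 (s≤s k'≥1))
      ; x = x ; y = y ; v = v ; x≢y = x≢y
      ; v-inj = λ {j} {j'} e → toℕ-injective (alt-inj (toℕ j) (toℕ j') (bound j) (bound j') e)
      ; x∉v = λ j e → proj₁ (apexes-outside j) (sym e)
      ; y∉v = λ j e → proj₂ (apexes-outside j) (sym e)
      ; x-edges = λ j → Admissible.edge (proj₁ (adj-next j))
      ; y-edges = λ j → Admissible.edge (proj₂ (adj-next j))
      } , Admissible.t∈T (proj₁ (adj 0 0 (s≤s z≤n) (s≤s z≤n))) , Admissible.t∈T (proj₂ (adj 0 0 (s≤s z≤n) (s≤s z≤n)))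

  -- The i-th entry of a list, with a default value beyond its end.
  entry : ∀ {A : Set} → List A → A → ℕ → A
  entry [] d i = d
  entry (x ∷ U) d zero = x
  entry (x ∷ U) d (suc i) = entry U d i

  entry-memb : ∀ {n} (U : List (Fin n)) d i → i < length U → T (memb (entry U d i) U)
  entry-memb (x ∷ U) d zero _ = memb-head x U
  entry-memb (x ∷ U) d (suc i) (s≤s i<) = T∨ʳ (does (entry U d i ≟F x)) (entry-memb U d i i<)
    where
    T∨ʳ : ∀ a {b} → T b → T (a ∨ b)
    T∨ʳ true _ = _
    T∨ʳ false t = t

  entry-inj : ∀ {n} (U : List (Fin n)) d → distinct U → ∀ i j → i < length U → j < length U →
              entry U d i ≡ entry U d j → i ≡ j
  entry-inj (x ∷ U) d _ zero zero _ _ _ = refl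
  entry-inj (x ∷ U) d (x∉U , _) zero (suc j) _ (s≤s j<) e =
    ⊥-elim (notT x∉U (subst (λ z → T (memb z U)) (sym e) (entry-memb U d j j<)))
  entry-inj (x ∷ U) d (x∉U , _) (suc i) zero (s≤s i<) _ e =
    ⊥-elim (notT x∉U (subst (λ z → T (memb z U)) e (entry-memb U d i i<)))
  entry-inj (x ∷ U) d (_ , distinctU) (suc i) (suc j) (s≤s i<) (s≤s j<) e = cong suc (entry-inj U d distinctU i j i< j< e)

  link : ∀ {n} (H : 3Graph n) (TT : Subset n) (x y : Fin n) → Fin n → Fin n → Bool
  link H TT x y a b = admissible H TT x a b ∧ admissible H TT y a b

  fromBiclique : ∀ {n} (H : 3Graph n) (TT : Subset n) {x y : Fin n} → x ≢ y → ∀ k' → 1 ≤ k' →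
    Biclique (link H TT x y) (suc k') →
    Σ (DoublePyramid H (2 * suc k')) λ P → (DoublePyramid.x P ∈ TT) × (DoublePyramid.y P ∈ TT)
  fromBiclique H TT {x} {y} x≢y k' k'≥1 B =
    Construction.pyramid H TT x≢y k' k'≥1 (entry U x) (entry W x) adj (inj U |U| U-distinct) (inj W |W| W-distinct)
    where
    open Biclique B
    adj : ∀ i j → i < suc k' → j < suc k' →
          Admissible H TT x (entry U x i) (entry W x j) × Admissible H TT y (entry U x i) (entry W x j)
    adj i j i< j< = toWitness (T∧₁ {admissible H TT x _ _} both) , toWitness (T∧₂ {admissible H TT x _ _} both)
      where
      both : T (link H TT x y (entry U x i) (entry W x j))
      both = complete (entry U x i) (entry W x j) (entry-memb U x i (subst (i <_) (sym |U|) i<))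
                                                  (entry-memb W x j (subst (j <_) (sym |W|) j<))
    inj : ∀ (L : List (Fin _)) → length L ≡ suc k' → distinct L →
          ∀ i j → i < suc k' → j < suc k' → entry L x i ≡ entry L x j → i ≡ j
    inj L |L| distinctL i j i< j< = entry-inj L x distinctL i j (subst (i <_) (sym |L|) i<) (subst (j <_) (sym |L|) j<)

-- From the rational density hypothesis to a natural-number one:
-- if δ > 0 then δ·N ≤ E implies N ≤ (D + 1)·E for D the denominator of δ.
module Density where

  open import Data.Nat using (ℕ; suc; _+_; _*_) renaming (_≤_ to _≤ₙ_)
  import Data.Nat.Properties as ℕ
  open import Data.Integer using (+_; -[1+_]; +[1+_]; +<+) renaming (_≤_ to _≤ℤ_)
  import Data.Integer.Properties as ℤ
  open import Data.Rational using (ℚ; mkℚ; 0ℚ; _<_; _≤_; *<*) renaming (_*_ to _*ℚ_)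
  open import Data.Rational.Properties using (toℚᵘ-homo-*; toℚᵘ-mono-≤; toℚᵘ-fromℚᵘ)
  open import Data.Rational.Unnormalised using (mkℚᵘ; *≤*) renaming (_*_ to _*ᵘ_; _≤_ to _≤ᵘ_)
  open import Data.Rational.Unnormalised.Properties using (≤-respˡ-≃; ≤-respʳ-≃; *-congˡ)
  open import Data.Product using (∃; _,_)
  open import Relation.Binary.PropositionalEquality
  open import Defs

  density-bound : ∀ (δ : ℚ) → 0ℚ < δ → ∃ λ D → ∀ N E → δ *ℚ ℕtoℚ N ≤ ℕtoℚ E → N ≤ₙ suc D * E
  density-bound (mkℚ +[1+ a ] d c) _ = d * 1 , λ N E h → integral N E (unnormalised N E h)
    where
    unnormalised : ∀ N E → mkℚ +[1+ a ] d c *ℚ ℕtoℚ N ≤ ℕtoℚ E → mkℚᵘ +[1+ a ] d *ᵘ mkℚᵘ (+ N) 0 ≤ᵘ mkℚᵘ (+ E) 0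
    unnormalised N E h = ≤-respʳ-≃ (toℚᵘ-fromℚᵘ (mkℚᵘ (+ E) 0))
      (≤-respˡ-≃ (*-congˡ {mkℚᵘ +[1+ a ] d} (toℚᵘ-fromℚᵘ (mkℚᵘ (+ N) 0)))
      (≤-respˡ-≃ (toℚᵘ-homo-* (mkℚ +[1+ a ] d c) (ℕtoℚ N)) (toℚᵘ-mono-≤ h)))
    -- Cross-multiplied: (a + 1)·N ≤ E·(d + 1), and N ≤ (a + 1)·N.
    integral : ∀ N E → mkℚᵘ +[1+ a ] d *ᵘ mkℚᵘ (+ N) 0 ≤ᵘ mkℚᵘ (+ E) 0 → N ≤ₙ suc (d * 1) * E
    integral N E (*≤* cross) = ℕ.≤-trans (ℕ.m≤m+n N (a * N)) (ℕ.≤-trans (ℤ.drop‿+≤+ cross')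
                                 (ℕ.≤-reflexive (ℕ.*-comm E (suc (d * 1)))))
      where
      cross' : + (suc a * N) ≤ℤ + (E * suc (d * 1))
      cross' = subst₂ _≤ℤ_ (trans (ℤ.*-identityʳ _) (sym (ℤ.pos-* (suc a) N))) (sym (ℤ.pos-* E (suc (d * 1)))) cross
  density-bound (mkℚ (+ 0) d c) (*<* (+<+ ()))
  density-bound (mkℚ -[1+ n ] d c) (*<* ())

-- We write n = K·m + (remainder), with K = 128·Dp², and use r = 32·Dp·m.
module Assembly where

  open import Data.Nat using (ℕ; suc; _+_; _*_; _∸_; _^_; _≤_; _<_; z≤n; s≤s; _/_; _%_; >-nonZero)
  open import Data.Nat.Properties
  open import Data.Nat.DivMod using (m/n*n≤m; m≡m%n+[m/n]*n; m%n<n)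
  open import Data.Nat.Tactic.RingSolver using (solve-∀)
  open import Data.Bool using (Bool; _∧_)
  open import Data.Fin using (Fin; remQuot)
  open import Data.Fin.Subset using (Subset; _∈_)
  open import Data.Product using (Σ; ∃₂; _×_; _,_; proj₁; proj₂)
  open import Relation.Binary.PropositionalEquality
  open import Defs
  open FinSum
  open Pruning using (edgeCount; size)
  open OrderedTriples
  open Bicliques
  open DoublePyramids

  double-half : ∀ Dp m → 32 * Dp * m ≡ 16 * Dp * m + 16 * Dp * m
  double-half = solve-∀

  triples-identity : ∀ Dp m n → Dp * (n * (n * (32 * Dp * m)) + n * n * (32 * Dp * m))
                                + Dp * (n * (n * (32 * Dp * m)) + n * n * (32 * Dp * m))
                                ≡ 128 * (Dp * Dp) * m * (n * n)
  triples-identity = solve-∀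

  link-identity : ∀ Dp m → 128 * (Dp * Dp) * (m + m) * m + 128 * (Dp * Dp) * (m + m) * m
                           ≡ 32 * Dp * m * (16 * Dp * m)
  link-identity = solve-∀

  ratio-identity : ∀ K m → K * (m + m) + K * (m + m) ≡ 4 * K * m
  ratio-identity = solve-∀

  module _ (D k' : ℕ) (k'≥1 : 1 ≤ k') where

    Dp K Q k m₀ n₀ : ℕ
    Dp = suc D
    K = 128 * (Dp * Dp)
    Q = 4 * K
    k = suc k'
    m₀ = Q ^ k' * k + 2 * k + 1
    n₀ = K * m₀

    module Scale (n : ℕ) (n₀≤n : n₀ ≤ n) where

      m : ℕ
      m = n / K

      Km≤n : K * m ≤ n
      Km≤n = subst (_≤ n) (*-comm m K) (m/n*n≤m n K)

      n<K[m+1] : n < K * suc m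
      n<K[m+1] = begin-strict
        n                  ≡⟨ m≡m%n+[m/n]*n n K ⟩
        n % K + m * K      <⟨ +-monoˡ-< (m * K) (m%n<n n K) ⟩
        K + m * K          ≡⟨ cong (K +_) (*-comm m K) ⟩
        K + K * m          ≡⟨ sym (*-suc K m) ⟩
        K * suc m          ∎
        where open ≤-Reasoning

      m₀≤m : m₀ ≤ m
      m₀≤m = ≤-pred (*-cancelˡ-< K m₀ (suc m) (≤-<-trans n₀≤n n<K[m+1]))

      m≥1 : 1 ≤ m
      m≥1 = ≤-trans (m≤n+m 1 (Q ^ k' * k + 2 * k)) m₀≤m

      1+m≤m+m : suc m ≤ m + m
      1+m≤m+m = subst (_≤ m + m) (+-comm m 1) (+-monoʳ-≤ m m≥1)

      n≥1 : 1 ≤ n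
      n≥1 = ≤-trans (*-mono-≤ {1} {K} (s≤s z≤n) m≥1) Km≤n

      n+n≤K[m+m] : n + n ≤ K * (m + m) + K * (m + m)
      n+n≤K[m+m] = +-mono-≤ bound bound
        where
        bound : n ≤ K * (m + m)
        bound = ≤-trans (<⇒≤ n<K[m+1]) (*-monoʳ-≤ K 1+m≤m+m)

      h r : ℕ
      h = 16 * Dp * m
      r = 32 * Dp * m

      h≥1 : 1 ≤ h
      h≥1 = *-mono-≤ {1} {16 * Dp} (s≤s z≤n) m≥1

      r≡h+h : r ≡ h + h
      r≡h+h = double-half Dp m

      r≥2 : 2 ≤ r
      r≥2 = subst (2 ≤_) (sym r≡h+h) (+-mono-≤ h≥1 h≥1)

      h≤r∸1 : h ≤ r ∸ 1
      h≤r∸1 = m+n≤o⇒m≤o∸n h (subst (h + 1 ≤_) (sym r≡h+h) (+-monoʳ-≤ h h≥1))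

      triples-dense : ∀ A → n * n * n ≤ Dp * A → n * (n * r) + n * n * r < A
      triples-dense A dense = *-cancelˡ-< Dp X A (begin-strict
        Dp * X               <⟨ m<m+n (Dp * X) (*-mono-≤ {1} {Dp} (s≤s z≤n) X≥1) ⟩
        Dp * X + Dp * X      ≡⟨ triples-identity Dp m n ⟩
        K * m * (n * n)      ≤⟨ *-monoˡ-≤ (n * n) Km≤n ⟩
        n * (n * n)          ≡⟨ sym (*-assoc n n n) ⟩
        n * n * n            ≤⟨ dense ⟩
        Dp * A               ∎)
        where
        open ≤-Reasoning
        X : ℕ
        X = n * (n * r) + n * n * r
        X≥1 : 1 ≤ X
        X≥1 = ≤-trans (*-mono-≤ n≥1 (*-mono-≤ n≥1 (≤-trans h≥1 (subst (h ≤_) (sym r≡h+h) (m≤m+n h h))))) (m≤m+n _ _)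

      link-dense : n * m + n * m < r * (r ∸ 1)
      link-dense = begin-strict
        n * m + n * m                      <⟨ +-mono-< (*-monoˡ-< m {{>-nonZero m≥1}} n<K[m+1]) (*-monoˡ-< m {{>-nonZero m≥1}} n<K[m+1]) ⟩
        K * suc m * m + K * suc m * m      ≤⟨ +-mono-≤ grow grow ⟩
        K * (m + m) * m + K * (m + m) * m  ≡⟨ link-identity Dp m ⟩
        r * h                              ≤⟨ *-monoʳ-≤ r h≤r∸1 ⟩
        r * (r ∸ 1)                        ∎
        where
        open ≤-Reasoning
        grow : K * suc m * m ≤ K * (m + m) * m
        grow = *-monoˡ-≤ m (*-monoʳ-≤ K 1+m≤m+m)

      ratio : n + n ≤ Q * m
      ratio = ≤-trans n+n≤K[m+m] (≤-reflexive (ratio-identity K m))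

      large : Q ^ k' * k + 2 * k < m
      large = subst (_≤ m) (+-comm (Q ^ k' * k + 2 * k) 1) m₀≤m

    denseCommonLink : ∀ n (n₀≤n : n₀ ≤ n) (H : 3Graph n) (TT : Subset n) → n * n * n ≤ Dp * edgesMeeting H TT →
      ∃₂ λ t₁ t₂ → t₁ ≢ t₂ × n * Scale.m n n₀≤n + n * Scale.m n n₀≤n < edgeCount (link H TT t₁ t₂)
    denseCommonLink n n₀≤n H TT dense = t₁ , t₂ , t₁≢t₂ , link-edges
      where
      open Scale n n₀≤n
      -- The bipartite graph between vertices t and ordered pairs (a, b).
      pairs : Fin n → Fin (n * n) → Bool
      pairs t p = admissible H TT t (proj₁ (remQuot {n} n p)) (proj₂ (remQuot {n} n p))
      pairs-edges : n * (n * r) + n * n * r < edgeCount pairs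
      pairs-edges = subst (_ <_) (sym (Σ-cong (λ t → Σ-pairs n (λ a b → ind (admissible H TT t a b)))))
                      (triples-dense (admissibleCount H TT) (≤-trans dense (*-monoʳ-≤ Dp (edgesMeeting≤admissible H TT))))
      apexes : ∃₂ λ t₁ t₂ → t₁ ≢ t₂ × r * (r ∸ 1) ≤ size (λ z → pairs t₁ z ∧ pairs t₂ z)
      apexes = commonPair pairs r r≥2 pairs-edges
      t₁ t₂ : Fin n
      t₁ = proj₁ apexes
      t₂ = proj₁ (proj₂ apexes)
      t₁≢t₂ : t₁ ≢ t₂
      t₁≢t₂ = proj₁ (proj₂ (proj₂ apexes))
      link-edges : n * m + n * m < edgeCount (link H TT t₁ t₂)
      link-edges = <-≤-trans link-dense (≤-trans (proj₂ (proj₂ (proj₂ apexes)))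
                     (≤-reflexive (Σ-pairs n (λ a b → ind (link H TT t₁ t₂ a b)))))

    core : ∀ n → n₀ ≤ n → (H : 3Graph n) (TT : Subset n) → n * n * n ≤ Dp * edgesMeeting H TT →
           Σ (DoublePyramid H (2 * k)) λ P → (DoublePyramid.x P ∈ TT) × (DoublePyramid.y P ∈ TT)
    core n n₀≤n H TT dense = fromBiclique H TT t₁≢t₂ k' k'≥1 (biclique (link H TT t₁ t₂) m Q k' link-edges ratio large)
      where
      open Scale n n₀≤n using (m; ratio; large)
      apexes : ∃₂ λ t₁ t₂ → t₁ ≢ t₂ × n * m + n * m < edgeCount (link H TT t₁ t₂)
      apexes = denseCommonLink n n₀≤n H TT dense
      t₁ t₂ : Fin n
      t₁ = proj₁ apexes
      t₂ = proj₁ (proj₂ apexes)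
      t₁≢t₂ : t₁ ≢ t₂
      t₁≢t₂ = proj₁ (proj₂ (proj₂ apexes))
      link-edges : n * m + n * m < edgeCount (link H TT t₁ t₂)
      link-edges = proj₂ (proj₂ (proj₂ apexes))

open import Defs
open import Data.Nat using (ℕ; zero; suc; _*_; _≥_; s≤s; z≤n)
open import Data.Fin.Subset using (Subset; _∈_)
open import Data.Product using (Σ; ∃; _×_; _,_; proj₁; proj₂)
open import Data.Rational using (ℚ; 0ℚ; 1ℚ; ½; _<_; _≤_) renaming (_*_ to _*ℚ_)
open import Data.Rational.Properties using (_<?_; _≤?_)
open import Relation.Nullary.Decidable using (toWitness; toWitnessFalse)
open import Relation.Binary.PropositionalEquality using (_≡_)
open import Data.Empty using (⊥-elim)
open Density using (density-bound)

-- c₀ = ½: the hypothesis 1 ≤ k/2 forces k ≥ 2, and then 'Assembly.core' applies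
-- with the density constant D obtained from δ.
lemma4p2 : ∃ λ (c₀ : ℚ) → 0ℚ < c₀ ×
             ((δ : ℚ) → 0ℚ < δ → δ ≤ c₀ →
              (k : ℕ) → 1ℚ ≤ c₀ *ℚ ℕtoℚ k →
              ∃ λ (n₀ : ℕ) → (n : ℕ) → n ≥ n₀ →
                (H : 3Graph n) (T : Subset n) →
                δ *ℚ ℕtoℚ (n * n * n) ≤ ℕtoℚ (edgesMeeting H T) →
                Σ (DoublePyramid H (2 * k)) λ P →
                  (DoublePyramid.x P ∈ T) × (DoublePyramid.y P ∈ T))
lemma4p2 = ½ , toWitness {a? = 0ℚ <? ½} _ , pyramids
  where
  pyramids : (δ : ℚ) → 0ℚ < δ → δ ≤ ½ → (k : ℕ) → 1ℚ ≤ ½ *ℚ ℕtoℚ k →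
             ∃ λ (n₀ : ℕ) → (n : ℕ) → n ≥ n₀ → (H : 3Graph n) (T : Subset n) →
               δ *ℚ ℕtoℚ (n * n * n) ≤ ℕtoℚ (edgesMeeting H T) →
               Σ (DoublePyramid H (2 * k)) λ P → (DoublePyramid.x P ∈ T) × (DoublePyramid.y P ∈ T)
  pyramids δ δ>0 _ zero k≥2 = ⊥-elim (toWitnessFalse {a? = 1ℚ ≤? ½ *ℚ ℕtoℚ 0} _ k≥2)
  pyramids δ δ>0 _ (suc zero) k≥2 = ⊥-elim (toWitnessFalse {a? = 1ℚ ≤? ½ *ℚ ℕtoℚ 1} _ k≥2)
  pyramids δ δ>0 _ (suc (suc k'')) _ = Assembly.n₀ D (suc k'') (s≤s z≤n) , λ n n≥n₀ H T dense →
    Assembly.core D (suc k'') (s≤s z≤n) n n≥n₀ H T (proj₂ (density-bound δ δ>0) (n * n * n) (edgesMeeting H T) dense)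
    where
    D : ℕ
    D = proj₁ (density-bound δ δ>0)
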